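{- Let $T$ be a tree on at least two vertices and let $\mathcal{H}$ be a TD-coloring of $T$ using $\chi_{td}(T)$ colors. Let $A$ be the set of vertices that form a color class of $\mathcal{H}$ by themselves, let $C_S$ be the set of color classes of $\mathcal{H}$ having more than one vertex and totally dominated by some vertex of $T$, and let $D_S$ be a set obtained by picking one vertex from each class in $C_S$. Then (a) every class $R\in C_S$ is totally dominated by exactly one vertex of $T$; (b) $A\cup D_S$ is a total dominating set of $T$.
   Context: A vertex $u$ totally dominates a set $R$ if $u$ is adjacent to every vertex of $R$. A total dominating set of a graph is a set $D$ such that every vertex has a neighbour in $D$. A total dominator coloring (TD-coloring) of a graph without isolated vertices is a proper vertex coloring in which every vertex totally dominates some color class; $\chi_{td}$ denotes the minimum number of colors in a TD-coloring. -}

module Defs where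

open import Level using (Level; suc; _⊔_) renaming (zero to lzero)
open import Data.Nat using (ℕ; _≤_)
open import Data.Fin using (Fin)
open import Data.List using (List; []; _∷_; _++_; [_]; length)
open import Data.List.Relation.Unary.Linked using (Linked)
open import Data.List.Relation.Unary.Unique.Propositional using (Unique)
open import Data.Product using (Σ; ∃; ∃-syntax; _×_; _,_)
open import Data.Sum using (_⊎_)
open import Relation.Nullary using (¬_)
open import Relation.Binary.PropositionalEquality using (_≡_; _≢_)

record Graph : Set₁ where
  field
    n      : ℕ
    E      : Fin n → Fin n → Set
    sym    : ∀ {u v} → E u v → E v u
    irrefl : ∀ {u} → ¬ E u u
open Graph public

data Walk (G : Graph) : Fin (n G) → Fin (n G) → Set where
  nil  : ∀ {u} → Walk G u u
  cons : ∀ {u w v} → E G u w → Walk G w v → Walk G u v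

Connected : Graph → Set
Connected G = ∀ u v → Walk G u v

IsCycle : (G : Graph) → Fin (n G) → List (Fin (n G)) → Set
IsCycle G u ys = (2 ≤ length ys) × Unique (u ∷ ys) × Linked (E G) (u ∷ ys ++ [ u ])

Acyclic : Graph → Set
Acyclic G = ∀ u ys → ¬ IsCycle G u ys

IsTree : Graph → Set
IsTree G = Connected G × Acyclic G

module _ (G : Graph) where

  TotallyDominates : Fin (n G) → (Fin (n G) → Set) → Set
  TotallyDominates u R = ∀ v → R v → E G u v

  IsTotalDominatingSet : (Fin (n G) → Set) → Set
  IsTotalDominatingSet D = ∀ v → ∃[ w ] (E G v w × D w)

  module _ {k : ℕ} (c : Fin (n G) → Fin k) where

    ColorClass : Fin k → Fin (n G) → Set
    ColorClass i v = c v ≡ i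

    Proper : Set
    Proper = ∀ {u v} → E G u v → c u ≢ c v

    -- the coloring uses all k colors (so Fin k indexes exactly the color classes)
    UsesAllColors : Set
    UsesAllColors = ∀ i → ∃[ v ] c v ≡ i

    IsTDColoring : Set
    IsTDColoring = Proper × UsesAllColors
                 × (∀ u → ∃[ i ] TotallyDominates u (ColorClass i))

  IsChiTD : ℕ → Set
  IsChiTD k = (∃[ c ] IsTDColoring {k} c)
            × (∀ m (c : Fin (n G) → Fin m) → IsTDColoring c → k ≤ m)

module Submission where

open import Defs
open import Data.Nat using (ℕ; _≤_; s≤s; z≤n)
open import Data.Fin using (Fin; _≟_)
open import Data.Fin.Properties using (any?)
open import Data.Product using (∃; ∃-syntax; _×_; _,_)
open import Data.Sum using (_⊎_; inj₁; inj₂)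
open import Data.List using ([]; _∷_)
open import Data.List.Relation.Unary.All using ([]; _∷_)
open import Data.List.Relation.Unary.AllPairs using ([]; _∷_)
open import Data.List.Relation.Unary.Linked using ([-]; _∷_)
open import Relation.Nullary using (yes; no)
open import Relation.Nullary.Decidable using (_×-dec_; ¬?)
open import Relation.Unary using (Pred; Decidable)
open import Data.Empty using (⊥-elim)
open import Relation.Binary.PropositionalEquality
  using (_≡_; _≢_; refl; trans) renaming (sym to ≡-sym)

-- (a) holds because a class with two vertices v ≠ w dominated by u ≠ u′ would give the
-- 4-cycle u v u′ w; (b) because the class totally dominated by a vertex x is either a
-- singleton, whose vertex lies in A, or has two vertices and so lies in C_S, in which
-- case its representative in D_S is a neighbour of x.

adjacent⇒≢ : (G : Graph) → ∀ {a b} → E G a b → a ≢ b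
adjacent⇒≢ G e refl = irrefl G e

commonNeighbour-unique : (G : Graph) → Acyclic G → ∀ {v w u u′} → v ≢ w
                       → E G u v → E G u w → E G u′ v → E G u′ w → u′ ≡ u
commonNeighbour-unique G acyclic {v} {w} {u} {u′} v≢w uv uw u′v u′w with u′ ≟ u
... | yes u′≡u = u′≡u
... | no u′≢u = ⊥-elim (acyclic u (v ∷ u′ ∷ w ∷ []) (s≤s (s≤s z≤n) , distinct , path))
  where
  path = uv ∷ sym G u′v ∷ u′w ∷ sym G uw ∷ [-]
  distinct = (adjacent⇒≢ G uv ∷ (λ e → u′≢u (≡-sym e)) ∷ adjacent⇒≢ G uw ∷ [])
           ∷ ((λ e → adjacent⇒≢ G u′v (≡-sym e)) ∷ v≢w ∷ [])
           ∷ (adjacent⇒≢ G u′w ∷ [])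
           ∷ [] ∷ []

singleton⊎∃other : ∀ {m p} {P : Pred (Fin m) p} → Decidable P → ∀ v
                 → (∀ y → P y → y ≡ v) ⊎ (∃[ y ] (y ≢ v × P y))
singleton⊎∃other {P = P} P? v with any? (λ y → ¬? (y ≟ v) ×-dec P? y)
... | yes (y , y≢v , Py) = inj₂ (y , y≢v , Py)
... | no ¬other = inj₁ only-v
  where
  only-v : ∀ y → P y → y ≡ v
  only-v y Py with y ≟ v
  ... | yes y≡v = y≡v
  ... | no y≢v = ⊥-elim (¬other (y , y≢v , Py))

lemma1 : (T : Graph) → IsTree T → 2 ≤ n T
         → (k : ℕ) → IsChiTD T k
         → (c : Fin (n T) → Fin k) → IsTDColoring T c
         → (d : (i : Fin k)
                → (∃[ v ] ∃[ w ] (v ≢ w × c v ≡ i × c w ≡ i))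
                → (∃[ u ] TotallyDominates T u (ColorClass T c i))
                → Fin (n T))
         → (∀ i p q → c (d i p q) ≡ i)
         → (∀ i → (∃[ v ] ∃[ w ] (v ≢ w × c v ≡ i × c w ≡ i))
                → (∃[ u ] TotallyDominates T u (ColorClass T c i))
                → ∃[ u ] (TotallyDominates T u (ColorClass T c i)
                          × (∀ u′ → TotallyDominates T u′ (ColorClass T c i) → u′ ≡ u)))
           × IsTotalDominatingSet T
               (λ x → (∀ y → c y ≡ c x → y ≡ x)
                      ⊎ (∃[ i ] ∃[ p ] ∃[ q ] d i p q ≡ x))
lemma1 T (_ , acyclic) _ k _ c (_ , usesAll , dominates) d d-colour = uniqueDominator , totalDomination
  where
  uniqueDominator : ∀ i → (∃[ v ] ∃[ w ] (v ≢ w × c v ≡ i × c w ≡ i))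
                  → (∃[ u ] TotallyDominates T u (ColorClass T c i))
                  → ∃[ u ] (TotallyDominates T u (ColorClass T c i)
                            × (∀ u′ → TotallyDominates T u′ (ColorClass T c i) → u′ ≡ u))
  uniqueDominator i (v , w , v≢w , cv , cw) (u , u-dom) =
    u , u-dom , λ u′ u′-dom →
      commonNeighbour-unique T acyclic v≢w (u-dom v cv) (u-dom w cw) (u′-dom v cv) (u′-dom w cw)

  totalDomination : IsTotalDominatingSet T
                      (λ x → (∀ y → c y ≡ c x → y ≡ x) ⊎ (∃[ i ] ∃[ p ] ∃[ q ] d i p q ≡ x))
  totalDomination x with dominates x
  ... | i , x-dom with usesAll i
  ... | v , cv with singleton⊎∃other (λ y → c y ≟ i) v
  ... | inj₁ only-v = v , x-dom v cv , inj₁ (λ y cy → only-v y (trans cy cv))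
  ... | inj₂ (y , y≢v , cy) = d i p q , x-dom (d i p q) (d-colour i p q) , inj₂ (i , p , q , refl)
    where
    p = y , v , y≢v , cy , cv
    q = x , x-dom
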